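{- Let $\mathbb{F}_q$ be a finite field. For each $x\in\mathbb{F}_q^*$ let $X(x),Y(x)\subset\mathbb{F}_q^*$ be arbitrary subsets, and put $T=\bigl(\sum_{x\in\mathbb{F}_q^*}|X(x)|\bigr)\bigl(\sum_{x\in\mathbb{F}_q^*}|Y(x)|\bigr)$. Let $S$ be the number of quadruples $(x,y,x',y')$ with $x,y\in\mathbb{F}_q^*$, $x'\in X(x)$, $y'\in Y(y)$ and $xy-x'y'=1$. Then $$S=\frac{T}{q}+\theta\sqrt{Tq},\qquad |\theta|\le 1+o(1),$$ where $o(1)$ denotes a quantity depending only on $q$ and tending to $0$ as $q\to\infty$ (uniformly in the choice of the sets $X(x),Y(x)$). -}

module Defs where

open import Data.Nat as ℕ using (ℕ; zero; suc)
open import Data.Bool using (Bool; true; false; _∧_)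
open import Data.Fin using (Fin)
import Data.Fin as Fin
open import Data.Fin.Subset using (Subset; _∈_; _∉_; ∣_∣)
open import Data.Fin.Subset.Properties using (_∈?_)
open import Data.Product using (∃)
open import Algebra.Core using (Op₁; Op₂)
open import Algebra.Structures using (IsCommutativeRing)
open import Relation.Binary.PropositionalEquality using (_≡_; _≢_)
open import Relation.Nullary using (does; ¬?)

-- A finite field with q elements, presented (up to isomorphism) on the
-- carrier Fin q with propositional equality: a commutative ring with
-- 0 ≠ 1 in which every nonzero element has a multiplicative inverse.
record FiniteField (q : ℕ) : Set where
  infixl 6 _+_ _-_
  infixl 7 _*_
  field
    _+_ _*_ : Op₂ (Fin q)
    -_      : Op₁ (Fin q)
    0# 1#   : Fin q
    isCommutativeRing : IsCommutativeRing _≡_ _+_ _*_ -_ 0# 1#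
    0≢1     : 0# ≢ 1#
    inverse : ∀ x → x ≢ 0# → ∃ λ y → x * y ≡ 1#

  _-_ : Op₂ (Fin q)
  x - y = x + (- y)

sumFin : ∀ {n} → (Fin n → ℕ) → ℕ
sumFin {zero}  f = 0
sumFin {suc n} f = f Fin.zero ℕ.+ sumFin (λ i → f (Fin.suc i))

𝟙 : Bool → ℕ
𝟙 true  = 1
𝟙 false = 0

module _ {q : ℕ} (F : FiniteField q) where
  open FiniteField F

  nonzero : Fin q → Bool
  nonzero x = does (¬? (x Fin.≟ 0#))

  sizeSum : (Fin q → Subset q) → ℕ
  sizeSum X = sumFin λ x → 𝟙 (nonzero x) ℕ.* ∣ X x ∣

  countT : (X Y : Fin q → Subset q) → ℕ
  countT X Y = sizeSum X ℕ.* sizeSum Y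

  countS : (X Y : Fin q → Subset q) → ℕ
  countS X Y =
    sumFin λ x → sumFin λ y → sumFin λ x' → sumFin λ y' →
      𝟙 (nonzero x ∧ nonzero y ∧ does (x' ∈? X x) ∧ does (y' ∈? Y y)
         ∧ does ((x * y - x' * y') Fin.≟ 1#))

module Submission where

-- We prove the
-- estimate with θ ≤ 1 exactly, i.e. with ε = 0:  (S − T/q)² ≤ T q.
--
-- Read (x , x′) as a point u of the plane F_q² and (y , y′) as the line
-- ℓ_w = {u : u₁ w₁ − u₂ w₂ = 1}.  With 0/1 weights α, β marking the two
-- families, a = Σ α, b = Σ β (so T = a b) and r(u) = Σ_w β(w) [u ∈ ℓ_w], we
-- have S = Σ_u α(u) r(u).  A line with w₁ ≠ 0 is the graph of an affine map,
-- so it has q points, and two distinct such lines meet at most once; hence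
-- Σ r = q b and Σ r² ≤ q b + b², which gives Σ_u (q r(u) − b)² ≤ q³ b.
-- Cauchy–Schwarz with the weights α ≤ 1 then yields
-- (q S − T)² = (Σ α (q r − b))² ≤ a q³ b = T q³, and we divide by q².

open import Data.Bool using (Bool; true; false; _∧_)
open import Data.Bool.Properties using (∧-conicalˡ; ∧-conicalʳ)
open import Data.Nat as ℕ using (ℕ; zero; suc)
open import Data.Fin using (Fin; zero; suc; _≟_)
open import Data.Fin.Subset using (Subset; ∣_∣; inside; outside)
open import Data.Fin.Subset.Properties using (_∈?_)
open import Data.Vec using ([]; _∷_)
import Data.Integer.Properties as ℤP
import Data.Fin.Properties as FinP
open import Data.Integer.Tactic.RingSolver using (solve-∀)
open import Function using (_∘_)
open import Relation.Binary.PropositionalEquality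
open import Relation.Nullary using (Dec; does; yes; no; contradiction)
open import Relation.Nullary.Decidable using (dec-false)
open import Defs using (FiniteField; sumFin; 𝟙; nonzero; sizeSum; countS; countT)

module IntegerSums where

  open import Data.Integer as ℤ using (ℤ; +_; -[1+_]; 0ℤ; 1ℤ; _+_; _*_; _≤_)

  open import Algebra.Properties.Semiring.Sum ℤP.+-*-semiring public
    using (sum-syntax; sum-cong-≗; ∑-distrib-+; ∑-comm; *-distribˡ-sum; sum-replicate-zero)

  𝟙ℤ : Bool → ℤ
  𝟙ℤ b = + 𝟙 b

  𝟙ℤ-∧ : ∀ a b → 𝟙ℤ (a ∧ b) ≡ 𝟙ℤ a * 𝟙ℤ b
  𝟙ℤ-∧ true  b = sym (ℤP.*-identityˡ (𝟙ℤ b))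
  𝟙ℤ-∧ false b = refl

  𝟙ℤ≤1 : ∀ b → 𝟙ℤ b ≤ 1ℤ
  𝟙ℤ≤1 true  = ℤP.≤-refl
  𝟙ℤ≤1 false = ℤ.+≤+ ℕ.z≤n

  𝟙ℤ-nonNeg : ∀ b → 0ℤ ≤ 𝟙ℤ b
  𝟙ℤ-nonNeg b = ℤ.+≤+ ℕ.z≤n

  𝟙ℤ-idem : ∀ b → 𝟙ℤ b * 𝟙ℤ b ≡ 𝟙ℤ b
  𝟙ℤ-idem true  = refl
  𝟙ℤ-idem false = refl

  guard-≡ : ∀ m {x y} → (m ≡ true → x ≡ y) → 𝟙ℤ m * x ≡ 𝟙ℤ m * y
  guard-≡ true  x≡y = cong (1ℤ *_) (x≡y refl)
  guard-≡ false _   = refl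

  guard-≤ : ∀ m {x y} → (m ≡ true → x ≤ y) → 𝟙ℤ m * x ≤ 𝟙ℤ m * y
  guard-≤ true  {x} {y} x≤y = subst₂ _≤_ (sym (ℤP.*-identityˡ x)) (sym (ℤP.*-identityˡ y)) (x≤y refl)
  guard-≤ false _         = ℤP.≤-refl

  *-nonNeg : ∀ {a b} → 0ℤ ≤ a → 0ℤ ≤ b → 0ℤ ≤ a * b
  *-nonNeg {a} {b} a≥0 b≥0 =
    subst (_≤ a * b) (ℤP.*-zeroʳ a) (ℤP.*-monoˡ-≤-nonNeg a {{ℤ.nonNegative a≥0}} b≥0)

  square-nonNeg : ∀ a → 0ℤ ≤ a * a
  square-nonNeg (+ n)    = subst (0ℤ ≤_) (ℤP.pos-* n n) (ℤ.+≤+ ℕ.z≤n)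
  square-nonNeg -[1+ n ] = ℤ.+≤+ ℕ.z≤n

  ∑-mono : ∀ {n} {f g : Fin n → ℤ} → (∀ i → f i ≤ g i) → ∑[ i < n ] f i ≤ ∑[ i < n ] g i
  ∑-mono {zero}  f≤g = ℤP.≤-refl
  ∑-mono {suc n} f≤g = ℤP.+-mono-≤ (f≤g zero) (∑-mono (f≤g ∘ suc))

  ∑-const : ∀ n c → ∑[ i < n ] c ≡ + n * c
  ∑-const zero    c = refl
  ∑-const (suc n) c = trans (cong (_+_ c) (∑-const n c)) (one-more (+ n) c)
    where
    one-more : ∀ m c → c + m * c ≡ (1ℤ + m) * c
    one-more = solve-∀

  ∑-zero : ∀ {n} {f : Fin n → ℤ} → (∀ i → f i ≡ 0ℤ) → ∑[ i < n ] f i ≡ 0ℤ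
  ∑-zero {n} f≡0 = trans (sum-cong-≗ f≡0) (sum-replicate-zero n)

  ∑-pick : ∀ {n} (c : Fin n) (f : Fin n → ℤ) → ∑[ j < n ] (𝟙ℤ (does (j ≟ c)) * f j) ≡ f c
  ∑-pick zero    f = begin
    1ℤ * f zero + ∑[ j < _ ] (0ℤ * f (suc j))
      ≡⟨ cong₂ _+_ (ℤP.*-identityˡ (f zero)) (∑-zero {f = λ j → 0ℤ * f (suc j)} (λ _ → refl)) ⟩
    f zero + 0ℤ
      ≡⟨ ℤP.+-identityʳ (f zero) ⟩
    f zero ∎
    where open ≡-Reasoning
  ∑-pick (suc c) f = trans (ℤP.+-identityˡ _) (∑-pick c (f ∘ suc))

  ∑-atMostOne : ∀ {n} {P : Fin n → Set} (P? : ∀ j → Dec (P j)) →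
                (∀ i j → P i → P j → i ≡ j) → ∑[ j < n ] 𝟙ℤ (does (P? j)) ≤ 1ℤ
  ∑-atMostOne {zero}  P? unique = ℤ.+≤+ ℕ.z≤n
  ∑-atMostOne {suc n} P? unique with P? zero
  ... | yes p₀ = ℤP.≤-reflexive (cong (_+_ 1ℤ) (∑-zero λ j →
                   cong 𝟙ℤ (dec-false (P? (suc j)) λ pⱼ → FinP.0≢1+n (unique zero (suc j) p₀ pⱼ))))
  ... | no _   = subst (_≤ 1ℤ) (sym (ℤP.+-identityˡ _))
                   (∑-atMostOne (P? ∘ suc) λ i j pᵢ pⱼ → FinP.suc-injective (unique (suc i) (suc j) pᵢ pⱼ))

  sumFin-ℤ : ∀ {n} (f : Fin n → ℕ) → + sumFin f ≡ ∑[ i < n ] (+ f i)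
  sumFin-ℤ {zero}  f = refl
  sumFin-ℤ {suc n} f = trans (ℤP.pos-+ (f zero) _) (cong (_+_ (+ f zero)) (sumFin-ℤ (f ∘ suc)))

  ∣p∣-as-sum : ∀ {n} (p : Subset n) → ∣ p ∣ ≡ sumFin (λ i → 𝟙 (does (i ∈? p)))
  ∣p∣-as-sum []            = refl
  ∣p∣-as-sum (inside ∷ p)  = cong suc (∣p∣-as-sum p)
  ∣p∣-as-sum (outside ∷ p) = ∣p∣-as-sum p

module PositiveLinearFunctionals where

  open import Data.Integer as ℤ using (ℤ; +_; 0ℤ; 1ℤ; _+_; _*_; -_; _-_; _≤_)
  open IntegerSums using (*-nonNeg; square-nonNeg)

  -- A positive linear functional on integer functions on I.  Finite sums
  -- are the instances we need; Cauchy–Schwarz and the expansion of a square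
  -- hold for all of them.
  record PositiveLinear (I : Set) : Set where
    field
      ∑      : (I → ℤ) → ℤ
      ∑-cong : ∀ {f g : I → ℤ} → (∀ i → f i ≡ g i) → ∑ f ≡ ∑ g
      ∑-+    : ∀ (f g : I → ℤ) → ∑ (λ i → f i + g i) ≡ ∑ f + ∑ g
      ∑-*    : ∀ c (f : I → ℤ) → ∑ (λ i → c * f i) ≡ c * ∑ f
      ∑-mono : ∀ {f g : I → ℤ} → (∀ i → f i ≤ g i) → ∑ f ≤ ∑ g

    ∑-lin₂ : ∀ a b (f g : I → ℤ) → ∑ (λ i → a * f i + b * g i) ≡ a * ∑ f + b * ∑ g
    ∑-lin₂ a b f g = trans (∑-+ (λ i → a * f i) (λ i → b * g i)) (cong₂ _+_ (∑-* a f) (∑-* b g))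

    ∑-lin₃ : ∀ a b c (f g h : I → ℤ) →
             ∑ (λ i → a * f i + b * g i + c * h i) ≡ a * ∑ f + b * ∑ g + c * ∑ h
    ∑-lin₃ a b c f g h =
      trans (∑-+ (λ i → a * f i + b * g i) (λ i → c * h i)) (cong₂ _+_ (∑-lin₂ a b f g) (∑-* c h))

    ∑-nonNeg : ∀ {f : I → ℤ} → (∀ i → 0ℤ ≤ f i) → 0ℤ ≤ ∑ f
    ∑-nonNeg {f} f≥0 = subst (_≤ ∑ f) ∑0≡0 (∑-mono f≥0)
      where
      ∑0≡0 : ∑ (λ _ → 0ℤ) ≡ 0ℤ
      ∑0≡0 = trans (∑-* 0ℤ (λ _ → 0ℤ)) (ℤP.*-zeroˡ (∑ (λ _ → 0ℤ)))

    ∑-product : ∀ (f g : I → ℤ) → ∑ f * ∑ g ≡ ∑ (λ i → ∑ (λ j → f i * g j))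
    ∑-product f g = begin
      ∑ f * ∑ g                        ≡⟨ ℤP.*-comm (∑ f) (∑ g) ⟩
      ∑ g * ∑ f                        ≡⟨ ∑-* (∑ g) f ⟨
      ∑ (λ i → ∑ g * f i)              ≡⟨ ∑-cong (λ i → ℤP.*-comm (∑ g) (f i)) ⟩
      ∑ (λ i → f i * ∑ g)              ≡⟨ ∑-cong (λ i → ∑-* (f i) g) ⟨
      ∑ (λ i → ∑ (λ j → f i * g j))   ∎
      where open ≡-Reasoning

    ∑-square-expand : ∀ c b (r : I → ℤ) →
      ∑ (λ i → (c * r i - b) * (c * r i - b)) ≡
      (c * c) * ∑ (λ i → r i * r i) + (- (+ 2) * c * b) * ∑ r + (b * b) * ∑ (λ _ → 1ℤ)
    ∑-square-expand c b r = trans (∑-cong (λ i → expand c b (r i)))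
      (∑-lin₃ (c * c) (- (+ 2) * c * b) (b * b) (λ i → r i * r i) r (λ _ → 1ℤ))
      where
      expand : ∀ c b x → (c * x - b) * (c * x - b) ≡ (c * c) * (x * x) + (- (+ 2) * c * b) * x + (b * b) * 1ℤ
      expand = solve-∀

    -- Cauchy–Schwarz for non-negative weights w:  (Σ w x)² ≤ (Σ w)(Σ w x²),
    -- because  Σᵢ Σⱼ wᵢ wⱼ (xᵢ − xⱼ)² = 2 (Σ w · Σ w x² − (Σ w x)²) ≥ 0.
    cauchySchwarz : ∀ (w x : I → ℤ) → (∀ i → 0ℤ ≤ w i) →
      ∑ (λ i → w i * x i) * ∑ (λ i → w i * x i) ≤ ∑ w * ∑ (λ i → w i * (x i * x i))
    cauchySchwarz w x w≥0 =
      ℤP.0≤i-j⇒j≤i (ℤP.*-cancelˡ-≤-pos 0ℤ (W * Q - P * P) (+ 2) (subst (0ℤ ≤_) spread≡ spread≥0))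
      where
      W P Q : ℤ
      W = ∑ w
      P = ∑ (λ i → w i * x i)
      Q = ∑ (λ i → w i * (x i * x i))
      spread : I → I → ℤ
      spread i j = w i * w j * ((x i - x j) * (x i - x j))
      expand : ∀ wᵢ wⱼ xᵢ xⱼ → wᵢ * wⱼ * ((xᵢ - xⱼ) * (xᵢ - xⱼ)) ≡
               (wᵢ * (xᵢ * xᵢ)) * wⱼ + (- (+ 2) * (wᵢ * xᵢ)) * (wⱼ * xⱼ) + wᵢ * (wⱼ * (xⱼ * xⱼ))
      expand = solve-∀
      regroup : ∀ W P Q wᵢ xᵢ → (wᵢ * (xᵢ * xᵢ)) * W + (- (+ 2) * (wᵢ * xᵢ)) * P + wᵢ * Q ≡
                W * (wᵢ * (xᵢ * xᵢ)) + (- (+ 2) * P) * (wᵢ * xᵢ) + Q * wᵢ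
      regroup = solve-∀
      collect : ∀ W P Q → W * Q + (- (+ 2) * P) * P + Q * W ≡ + 2 * (W * Q - P * P)
      collect = solve-∀
      row≡ : ∀ i → ∑ (spread i) ≡ W * (w i * (x i * x i)) + (- (+ 2) * P) * (w i * x i) + Q * w i
      row≡ i = trans (∑-cong (λ j → expand (w i) (w j) (x i) (x j)))
        (trans (∑-lin₃ (w i * (x i * x i)) (- (+ 2) * (w i * x i)) (w i) w (λ j → w j * x j) (λ j → w j * (x j * x j)))
               (regroup W P Q (w i) (x i)))
      spread≡ : ∑ (λ i → ∑ (spread i)) ≡ + 2 * (W * Q - P * P)
      spread≡ = trans (∑-cong row≡)
        (trans (∑-lin₃ W (- (+ 2) * P) Q (λ i → w i * (x i * x i)) (λ i → w i * x i) w) (collect W P Q))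
      spread≥0 : 0ℤ ≤ ∑ (λ i → ∑ (spread i))
      spread≥0 = ∑-nonNeg λ i → ∑-nonNeg λ j →
        *-nonNeg (*-nonNeg (w≥0 i) (w≥0 j)) (square-nonNeg (x i - x j))

module GridSums where

  open import Data.Integer as ℤ using (ℤ; +_; 0ℤ; 1ℤ; _+_; _*_)
  open import Data.Product using (_×_; _,_; proj₁; proj₂)
  open import Data.Sum using (_⊎_; inj₁; inj₂)
  open IntegerSums
  open PositiveLinearFunctionals

  ∑ₚ : ∀ {m n} → (Fin m × Fin n → ℤ) → ℤ
  ∑ₚ {m} {n} f = ∑[ i < m ] ∑[ j < n ] f (i , j)

  gridSum : ∀ m n → PositiveLinear (Fin m × Fin n)
  gridSum m n = record
    { ∑      = ∑ₚ
    ; ∑-cong = λ f≡g → sum-cong-≗ (λ i → sum-cong-≗ (λ j → f≡g (i , j)))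
    ; ∑-+    = λ f g → trans (sum-cong-≗ (λ i → ∑-distrib-+ (λ j → f (i , j)) (λ j → g (i , j))))
                             (∑-distrib-+ (λ i → ∑[ j < n ] f (i , j)) (λ i → ∑[ j < n ] g (i , j)))
    ; ∑-*    = λ c f → trans (sum-cong-≗ (λ i → sym (*-distribˡ-sum c (λ j → f (i , j)))))
                             (sym (*-distribˡ-sum c (λ i → ∑[ j < n ] f (i , j))))
    ; ∑-mono = λ f≤g → ∑-mono (λ i → ∑-mono (λ j → f≤g (i , j)))
    }

  ∑ₚ-const : ∀ m n c → ∑ₚ {m} {n} (λ _ → c) ≡ + m * (+ n * c)
  ∑ₚ-const m n c = begin
    ∑[ i < m ] ∑[ j < n ] c ≡⟨ sum-cong-≗ {m} (λ _ → ∑-const n c) ⟩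
    ∑[ i < m ] (+ n * c)    ≡⟨ ∑-const m (+ n * c) ⟩
    + m * (+ n * c)         ∎
    where open ≡-Reasoning

  ∑ₚ-comm : ∀ {m n m′ n′} (f : Fin m × Fin n → Fin m′ × Fin n′ → ℤ) →
            ∑ₚ (λ u → ∑ₚ (λ w → f u w)) ≡ ∑ₚ (λ w → ∑ₚ (λ u → f u w))
  ∑ₚ-comm {m} {n} {m′} {n′} f = begin
    ∑[ a < m ] ∑[ b < n ] ∑[ c < m′ ] ∑[ d < n′ ] f (a , b) (c , d)
      ≡⟨ sum-cong-≗ (λ a → ∑-comm (λ b c → ∑[ d < n′ ] f (a , b) (c , d))) ⟩
    ∑[ a < m ] ∑[ c < m′ ] ∑[ b < n ] ∑[ d < n′ ] f (a , b) (c , d)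
      ≡⟨ sum-cong-≗ (λ a → sum-cong-≗ (λ c → ∑-comm (λ b d → f (a , b) (c , d)))) ⟩
    ∑[ a < m ] ∑[ c < m′ ] ∑[ d < n′ ] ∑[ b < n ] f (a , b) (c , d)
      ≡⟨ ∑-comm (λ a c → ∑[ d < n′ ] ∑[ b < n ] f (a , b) (c , d)) ⟩
    ∑[ c < m′ ] ∑[ a < m ] ∑[ d < n′ ] ∑[ b < n ] f (a , b) (c , d)
      ≡⟨ sum-cong-≗ (λ c → ∑-comm (λ a d → ∑[ b < n ] f (a , b) (c , d))) ⟩
    ∑[ c < m′ ] ∑[ d < n′ ] ∑[ a < m ] ∑[ b < n ] f (a , b) (c , d) ∎
    where open ≡-Reasoning

  δ : ∀ {m n} → Fin m × Fin n → Fin m × Fin n → ℤ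
  δ (z₁ , z₂) (w₁ , w₂) = 𝟙ℤ (does (z₁ ≟ w₁)) * 𝟙ℤ (does (z₂ ≟ w₂))

  δ-cases : ∀ {m n} (z w : Fin m × Fin n) → (z ≡ w × δ z w ≡ 1ℤ) ⊎ (z ≢ w × δ z w ≡ 0ℤ)
  δ-cases (z₁ , z₂) (w₁ , w₂) with z₁ ≟ w₁ | z₂ ≟ w₂
  ... | yes refl | yes refl = inj₁ (refl , refl)
  ... | no z₁≢w₁ | _        = inj₂ ((λ z≡w → z₁≢w₁ (cong proj₁ z≡w)) , refl)
  ... | yes _    | no z₂≢w₂ = inj₂ ((λ z≡w → z₂≢w₂ (cong proj₂ z≡w)) , refl)

  ∑ₚ-pick : ∀ {m n} (w : Fin m × Fin n) (f : Fin m × Fin n → ℤ) → ∑ₚ (λ z → δ z w * f z) ≡ f w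
  ∑ₚ-pick {m} {n} (w₁ , w₂) f = begin
    ∑[ z₁ < m ] ∑[ z₂ < n ] (𝟙ℤ (does (z₁ ≟ w₁)) * 𝟙ℤ (does (z₂ ≟ w₂)) * f (z₁ , z₂))
      ≡⟨ sum-cong-≗ (λ z₁ → trans (sum-cong-≗ (λ z₂ → ℤP.*-assoc (𝟙ℤ (does (z₁ ≟ w₁))) (𝟙ℤ (does (z₂ ≟ w₂))) (f (z₁ , z₂))))
                                  (sym (*-distribˡ-sum (𝟙ℤ (does (z₁ ≟ w₁))) (λ z₂ → 𝟙ℤ (does (z₂ ≟ w₂)) * f (z₁ , z₂))))) ⟩
    ∑[ z₁ < m ] (𝟙ℤ (does (z₁ ≟ w₁)) * ∑[ z₂ < n ] (𝟙ℤ (does (z₂ ≟ w₂)) * f (z₁ , z₂)))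
      ≡⟨ sum-cong-≗ (λ z₁ → cong (𝟙ℤ (does (z₁ ≟ w₁)) *_) (∑-pick w₂ (λ z₂ → f (z₁ , z₂)))) ⟩
    ∑[ z₁ < m ] (𝟙ℤ (does (z₁ ≟ w₁)) * f (z₁ , w₂))
      ≡⟨ ∑-pick w₁ (λ z₁ → f (z₁ , w₂)) ⟩
    f (w₁ , w₂) ∎
    where open ≡-Reasoning

module Lines {q : ℕ} (F : FiniteField q) where

  open import Algebra.Bundles using (CommutativeRing)
  open import Data.Product using (_×_; _,_; proj₁; proj₂)
  open import Function using (_⇔_; mk⇔; Equivalence)
  open import Function.Properties.Equivalence using () renaming (trans to ⇔-trans)
  open FiniteField F

  commutativeRing : CommutativeRing _ _
  commutativeRing = record { isCommutativeRing = isCommutativeRing }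

  open CommutativeRing commutativeRing using (*-assoc; *-comm; *-identityˡ; *-identityʳ; +-identityˡ; +-abelianGroup)
  open import Algebra.Properties.AbelianGroup +-abelianGroup using (//-rightDividesˡ; //-rightDividesʳ)
    renaming (∙-cancelʳ to +-cancelʳ)
  open import Algebra.Solver.Ring.NaturalCoefficients.Default (CommutativeRing.commutativeSemiring commutativeRing)
  open ≡-Reasoning

  -≡⇔ : ∀ {a b c} → a - b ≡ c ⇔ a ≡ c + b
  -≡⇔ {a} {b} {c} = mk⇔ (λ e → trans (sym (//-rightDividesˡ b a)) (cong (_+ b) e))
                         (λ e → trans (cong (_- b) e) (//-rightDividesʳ b c))

  unit-⇔ : ∀ {w i a b} → w * i ≡ 1# → a * w ≡ b ⇔ a ≡ b * i
  unit-⇔ {w} {i} {a} {b} wi≡1 = mk⇔ to from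
    where
    to : a * w ≡ b → a ≡ b * i
    to e = begin
      a           ≡⟨ sym (*-identityʳ a) ⟩
      a * 1#      ≡⟨ cong (a *_) (sym wi≡1) ⟩
      a * (w * i) ≡⟨ sym (*-assoc a w i) ⟩
      a * w * i   ≡⟨ cong (_* i) e ⟩
      b * i       ∎
    from : a ≡ b * i → a * w ≡ b
    from e = begin
      a * w       ≡⟨ cong (_* w) e ⟩
      b * i * w   ≡⟨ *-assoc b i w ⟩
      b * (i * w) ≡⟨ cong (b *_) (trans (*-comm i w) wi≡1) ⟩
      b * 1#      ≡⟨ *-identityʳ b ⟩
      b           ∎

  inv : ∀ x → x ≢ 0# → Fin q
  inv x x≢0 = proj₁ (inverse x x≢0)

  inv-correct : ∀ x (x≢0 : x ≢ 0#) → x * inv x x≢0 ≡ 1#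
  inv-correct x x≢0 = proj₂ (inverse x x≢0)

  *-cancelʳ-≢0 : ∀ {a b c} → c ≢ 0# → a * c ≡ b * c → a ≡ b
  *-cancelʳ-≢0 {a} {b} {c} c≢0 e =
    trans (Equivalence.to c-unit refl) (sym (Equivalence.to c-unit (sym e)))
    where
    c-unit : ∀ {x y} → x * c ≡ y ⇔ x ≡ y * inv c c≢0
    c-unit = unit-⇔ (inv-correct c c≢0)

  affine-agree : ∀ {a b c d t s} → t ≢ s → a + t * b ≡ c + t * d → a + s * b ≡ c + s * d → a ≡ c × b ≡ d
  affine-agree {a} {b} {c} {d} {t} {s} t≢s eₜ eₛ = a≡c , b≡d
    where
    D : Fin q
    D = t - s
    D≢0 : D ≢ 0#
    D≢0 D≡0 = t≢s (trans (Equivalence.to -≡⇔ D≡0) (+-identityˡ s))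
    t≡D+s : t ≡ D + s
    t≡D+s = sym (//-rightDividesˡ s t)
    cross : t * b + s * d ≡ t * d + s * b
    cross = +-cancelʳ (a + c) _ _ (begin
      (t * b + s * d) + (a + c) ≡⟨ solve 6 (λ a b c d t s → (t :* b :+ s :* d) :+ (a :+ c) := (a :+ t :* b) :+ (c :+ s :* d)) refl a b c d t s ⟩
      (a + t * b) + (c + s * d) ≡⟨ cong₂ _+_ eₜ (sym eₛ) ⟩
      (c + t * d) + (a + s * b) ≡⟨ solve 6 (λ a b c d t s → (c :+ t :* d) :+ (a :+ s :* b) := (t :* d :+ s :* b) :+ (a :+ c)) refl a b c d t s ⟩
      (t * d + s * b) + (a + c) ∎)
    b≡d : b ≡ d
    b≡d = *-cancelʳ-≢0 D≢0 (+-cancelʳ (s * b + s * d) _ _ (begin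
      b * D + (s * b + s * d) ≡⟨ solve 4 (λ b d D s → b :* D :+ (s :* b :+ s :* d) := (D :+ s) :* b :+ s :* d) refl b d D s ⟩
      (D + s) * b + s * d     ≡⟨ subst (λ x → x * b + s * d ≡ x * d + s * b) t≡D+s cross ⟩
      (D + s) * d + s * b     ≡⟨ solve 4 (λ b d D s → (D :+ s) :* d :+ s :* b := d :* D :+ (s :* b :+ s :* d)) refl b d D s ⟩
      d * D + (s * b + s * d) ∎))
    a≡c : a ≡ c
    a≡c = +-cancelʳ (t * b) _ _ (trans eₜ (cong (λ x → c + t * x) (sym b≡d)))

  -- Points of the plane; a point w also names the line ℓ_w.
  Point : Set
  Point = Fin q × Fin q

  _∈ℓ_ : Point → Point → Set
  (u₁ , u₂) ∈ℓ (w₁ , w₂) = u₁ * w₁ - u₂ * w₂ ≡ 1#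

  _∈ℓ?_ : ∀ u w → Dec (u ∈ℓ w)
  (u₁ , u₂) ∈ℓ? (w₁ , w₂) = (u₁ * w₁ - u₂ * w₂) ≟ 1#

  graph : (w : Point) → proj₁ w ≢ 0# → Fin q → Fin q
  graph (w₁ , w₂) w₁≢0 t = (1# + t * w₂) * inv w₁ w₁≢0

  ∈ℓ⇔graph : ∀ {u₁ u₂ w₁ w₂} (w₁≢0 : w₁ ≢ 0#) → (u₁ , u₂) ∈ℓ (w₁ , w₂) ⇔ u₁ ≡ graph (w₁ , w₂) w₁≢0 u₂
  ∈ℓ⇔graph {w₁ = w₁} w₁≢0 = ⇔-trans -≡⇔ (unit-⇔ (inv-correct w₁ w₁≢0))

  graph-injective : ∀ {w z t s} (w₁≢0 : proj₁ w ≢ 0#) (z₁≢0 : proj₁ z ≢ 0#) → t ≢ s →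
    graph w w₁≢0 t ≡ graph z z₁≢0 t → graph w w₁≢0 s ≡ graph z z₁≢0 s → w ≡ z
  graph-injective {w₁ , w₂} {z₁ , z₂} {t} {s} w₁≢0 z₁≢0 t≢s eₜ eₛ = cong₂ _,_ w₁≡z₁ w₂≡z₂
    where
    i j : Fin q
    i = inv w₁ w₁≢0
    j = inv z₁ z₁≢0
    affine : ∀ x y k → (1# + x * y) * k ≡ k + x * (y * k)
    affine = solve 3 (λ x y k → (con 1 :+ x :* y) :* k := k :+ x :* (y :* k)) refl
    -- intercepts and slopes of the two graphs coincide
    agree : i ≡ j × w₂ * i ≡ z₂ * j
    agree = affine-agree t≢s (trans (sym (affine t w₂ i)) (trans eₜ (affine t z₂ j)))
                             (trans (sym (affine s w₂ i)) (trans eₛ (affine s z₂ j)))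
    i≡j : i ≡ j
    i≡j = proj₁ agree
    i·w₁≡1 : i * w₁ ≡ 1#
    i·w₁≡1 = trans (*-comm i w₁) (inv-correct w₁ w₁≢0)
    j·z₁≡1 : j * z₁ ≡ 1#
    j·z₁≡1 = trans (*-comm j z₁) (inv-correct z₁ z₁≢0)
    w₁≡z₁ : w₁ ≡ z₁
    w₁≡z₁ = trans (Equivalence.to (unit-⇔ j·z₁≡1) (subst (λ k → w₁ * k ≡ 1#) i≡j (inv-correct w₁ w₁≢0)))
                  (*-identityˡ z₁)
    w₂≡z₂ : w₂ ≡ z₂
    w₂≡z₂ = begin
      w₂             ≡⟨ Equivalence.to (unit-⇔ i·w₁≡1) (proj₂ agree) ⟩
      (z₂ * j) * w₁  ≡⟨ cong ((z₂ * j) *_) w₁≡z₁ ⟩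
      (z₂ * j) * z₁  ≡⟨ Equivalence.from (unit-⇔ (inv-correct z₁ z₁≢0)) refl ⟩
      z₂             ∎

module LineCounts {q : ℕ} (F : FiniteField q) where

  open import Data.Integer as ℤ using (ℤ; +_; 0ℤ; 1ℤ; _+_; _*_; _≤_)
  open import Data.Product using (_,_; proj₁)
  open import Data.Sum using (inj₁; inj₂)
  open import Function using (Equivalence)
  open import Relation.Nullary.Decidable using (does-⇔)
  open IntegerSums
  open GridSums
  open Lines F
  open FiniteField F using (0#)

  incidence : Point → Point → ℤ
  incidence u w = 𝟙ℤ (does (u ∈ℓ? w))

  ∑-along-line : ∀ {w} (w₁≢0 : proj₁ w ≢ 0#) (g : Point → ℤ) →
    ∑ₚ (λ u → incidence u w * g u) ≡ ∑[ t < q ] g (graph w w₁≢0 t , t)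
  ∑-along-line {w} w₁≢0 g = begin
    ∑[ u₁ < q ] ∑[ u₂ < q ] (incidence (u₁ , u₂) w * g (u₁ , u₂))
      ≡⟨ ∑-comm (λ u₁ u₂ → incidence (u₁ , u₂) w * g (u₁ , u₂)) ⟩
    ∑[ t < q ] ∑[ u₁ < q ] (incidence (u₁ , t) w * g (u₁ , t))
      ≡⟨ sum-cong-≗ {q} (λ t → sum-cong-≗ {q} (λ u₁ →
           cong (λ b → 𝟙ℤ b * g (u₁ , t)) (does-⇔ (∈ℓ⇔graph w₁≢0) ((u₁ , t) ∈ℓ? w) (u₁ ≟ graph w w₁≢0 t)))) ⟩
    ∑[ t < q ] ∑[ u₁ < q ] (𝟙ℤ (does (u₁ ≟ graph w w₁≢0 t)) * g (u₁ , t))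
      ≡⟨ sum-cong-≗ {q} (λ t → ∑-pick (graph w w₁≢0 t) (λ u₁ → g (u₁ , t))) ⟩
    ∑[ t < q ] g (graph w w₁≢0 t , t) ∎
    where open ≡-Reasoning

  line-size : ∀ {w} → proj₁ w ≢ 0# → ∑ₚ (λ u → incidence u w) ≡ + q
  line-size {w} w₁≢0 = begin
    ∑ₚ (λ u → incidence u w)           ≡⟨ sum-cong-≗ {q} (λ u₁ → sum-cong-≗ {q} (λ u₂ → sym (ℤP.*-identityʳ _))) ⟩
    ∑ₚ (λ u → incidence u w * 1ℤ)      ≡⟨ ∑-along-line w₁≢0 (λ _ → 1ℤ) ⟩
    ∑[ t < q ] 1ℤ                      ≡⟨ ∑-const q 1ℤ ⟩
    + q * 1ℤ                           ≡⟨ ℤP.*-identityʳ (+ q) ⟩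
    + q                                ∎
    where open ≡-Reasoning

  common-points : ∀ {w z} → proj₁ w ≢ 0# → proj₁ z ≢ 0# →
    ∑ₚ (λ u → incidence u w * incidence u z) ≤ + q * δ z w + 1ℤ
  common-points {w} {z} w₁≢0 z₁≢0 with δ-cases z w
  ... | inj₁ (refl , δ≡1) = begin
    ∑ₚ (λ u → incidence u w * incidence u w)
      ≡⟨ ∑-along-line w₁≢0 (λ u → incidence u w) ⟩
    ∑[ t < q ] incidence (graph w w₁≢0 t , t) w
      ≤⟨ ∑-mono {q} (λ t → 𝟙ℤ≤1 (does ((graph w w₁≢0 t , t) ∈ℓ? w))) ⟩
    ∑[ t < q ] 1ℤ
      ≡⟨ ∑-const q 1ℤ ⟩
    + q * 1ℤ
      ≤⟨ ℤP.i≤i+j (+ q * 1ℤ) 1ℤ ⟩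
    + q * 1ℤ + 1ℤ
      ≡⟨ cong (λ d → + q * d + 1ℤ) (sym δ≡1) ⟩
    + q * δ w w + 1ℤ ∎
    where open ℤP.≤-Reasoning
  ... | inj₂ (z≢w , δ≡0) = begin
    ∑ₚ (λ u → incidence u w * incidence u z)
      ≡⟨ ∑-along-line w₁≢0 (λ u → incidence u z) ⟩
    ∑[ t < q ] incidence (graph w w₁≢0 t , t) z
      ≤⟨ ∑-atMostOne (λ t → (graph w w₁≢0 t , t) ∈ℓ? z) unique ⟩
    1ℤ
      ≡⟨ sym (ℤP.+-identityˡ 1ℤ) ⟩
    0ℤ + 1ℤ
      ≡⟨ cong (_+ 1ℤ) (sym (trans (cong (+ q *_) δ≡0) (ℤP.*-zeroʳ (+ q)))) ⟩
    + q * δ z w + 1ℤ ∎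
    where
    open ℤP.≤-Reasoning
    -- a second common point would force ℓ_w = ℓ_z
    unique : ∀ t s → (graph w w₁≢0 t , t) ∈ℓ z → (graph w w₁≢0 s , s) ∈ℓ z → t ≡ s
    unique t s t∈ s∈ with t ≟ s
    ... | yes t≡s = t≡s
    ... | no t≢s  = contradiction (sym (graph-injective w₁≢0 z₁≢0 t≢s
                      (Equivalence.to (∈ℓ⇔graph z₁≢0) t∈) (Equivalence.to (∈ℓ⇔graph z₁≢0) s∈))) z≢w

module Estimate {q : ℕ} (F : FiniteField q) (X Y : Fin q → Subset q) where

  open import Data.Integer as ℤ using (ℤ; +_; 1ℤ; _+_; _*_; -_; _-_; _≤_)
  open import Data.Product using (_,_; proj₁)
  open IntegerSums
  open GridSums
  open PositiveLinearFunctionals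
  open PositiveLinear (gridSum q q) using (cauchySchwarz) renaming
    (∑-cong to ∑ₚ-cong; ∑-* to ∑ₚ-*; ∑-mono to ∑ₚ-mono; ∑-lin₂ to ∑ₚ-lin₂; ∑-product to ∑ₚ-product;
     ∑-square-expand to ∑ₚ-square-expand; ∑-nonNeg to ∑ₚ-nonNeg)
  open Lines F using (Point; _∈ℓ?_)
  open LineCounts F
  open FiniteField F using (0#)

  member : (Fin q → Subset q) → Point → Bool
  member Z (x , x′) = nonzero F x ∧ does (x′ ∈? Z x)

  member⇒x≢0 : ∀ Z w → member Z w ≡ true → proj₁ w ≢ 0#
  member⇒x≢0 Z (x , x′) h with x ≟ 0#
  member⇒x≢0 Z (x , x′) () | yes _
  ... | no x≢0 = x≢0

  α β : Point → ℤ
  α u = 𝟙ℤ (member X u)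
  β w = 𝟙ℤ (member Y w)

  a b : ℤ
  a = ∑ₚ α
  b = ∑ₚ β

  r : Point → ℤ
  r u = ∑ₚ (λ w → β w * incidence u w)

  -- First moment: every weighted line has q points.
  ∑r : ∑ₚ r ≡ + q * b
  ∑r = begin
    ∑ₚ (λ u → ∑ₚ (λ w → β w * incidence u w)) ≡⟨ ∑ₚ-comm (λ u w → β w * incidence u w) ⟩
    ∑ₚ (λ w → ∑ₚ (λ u → β w * incidence u w)) ≡⟨ ∑ₚ-cong (λ w → ∑ₚ-* (β w) (λ u → incidence u w)) ⟩
    ∑ₚ (λ w → β w * ∑ₚ (λ u → incidence u w)) ≡⟨ ∑ₚ-cong (λ w → guard-≡ (member Y w) (λ h → line-size (member⇒x≢0 Y w h))) ⟩
    ∑ₚ (λ w → β w * + q)                      ≡⟨ ∑ₚ-cong (λ w → ℤP.*-comm (β w) (+ q)) ⟩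
    ∑ₚ (λ w → + q * β w)                      ≡⟨ ∑ₚ-* (+ q) β ⟩
    + q * b                                   ∎
    where open ≡-Reasoning

  common : Point → Point → ℤ
  common w z = ∑ₚ (λ u → incidence u w * incidence u z)

  ∑r²≡ : ∑ₚ (λ u → r u * r u) ≡ ∑ₚ (λ w → ∑ₚ (λ z → (β w * β z) * common w z))
  ∑r²≡ = begin
    ∑ₚ (λ u → r u * r u)                                ≡⟨ ∑ₚ-cong (λ u → ∑ₚ-product (λ w → β w * incidence u w) (λ z → β z * incidence u z)) ⟩
    ∑ₚ (λ u → ∑ₚ (λ w → ∑ₚ (λ z → triple u w z)))       ≡⟨ ∑ₚ-comm (λ u w → ∑ₚ (λ z → triple u w z)) ⟩
    ∑ₚ (λ w → ∑ₚ (λ u → ∑ₚ (λ z → triple u w z)))       ≡⟨ ∑ₚ-cong (λ w → ∑ₚ-comm (λ u z → triple u w z)) ⟩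
    ∑ₚ (λ w → ∑ₚ (λ z → ∑ₚ (λ u → triple u w z)))       ≡⟨ ∑ₚ-cong (λ w → ∑ₚ-cong (λ z → factor w z)) ⟩
    ∑ₚ (λ w → ∑ₚ (λ z → (β w * β z) * common w z))      ∎
    where
    open ≡-Reasoning
    triple : Point → Point → Point → ℤ
    triple u w z = (β w * incidence u w) * (β z * incidence u z)
    interchange : ∀ p x s y → (p * x) * (s * y) ≡ (p * s) * (x * y)
    interchange = solve-∀
    factor : ∀ w z → ∑ₚ (λ u → triple u w z) ≡ (β w * β z) * common w z
    factor w z = trans (∑ₚ-cong (λ u → interchange (β w) (incidence u w) (β z) (incidence u z)))
                       (∑ₚ-* (β w * β z) (λ u → incidence u w * incidence u z))

  -- Two weighted lines share q points if equal and at most one otherwise.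
  pair-bound : ∀ w z → (β w * β z) * common w z ≤ (β w * β z) * (+ q * δ z w + 1ℤ)
  pair-bound w z = subst (λ c → c * common w z ≤ c * (+ q * δ z w + 1ℤ)) (𝟙ℤ-∧ (member Y w) (member Y z))
    (guard-≤ (member Y w ∧ member Y z) λ h →
      common-points (member⇒x≢0 Y w (∧-conicalˡ (member Y w) (member Y z) h)) (member⇒x≢0 Y z (∧-conicalʳ (member Y w) (member Y z) h)))

  row-sum : ∀ w → ∑ₚ (λ z → (β w * β z) * (+ q * δ z w + 1ℤ)) ≡ + q * β w + b * β w
  row-sum w = begin
    ∑ₚ (λ z → (β w * β z) * (+ q * δ z w + 1ℤ))          ≡⟨ ∑ₚ-cong (λ z → split (β w) (β z) (+ q) (δ z w)) ⟩
    ∑ₚ (λ z → (+ q * β w) * (δ z w * β z) + β w * β z)   ≡⟨ ∑ₚ-lin₂ (+ q * β w) (β w) (λ z → δ z w * β z) β ⟩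
    (+ q * β w) * ∑ₚ (λ z → δ z w * β z) + β w * b       ≡⟨ cong (λ x → (+ q * β w) * x + β w * b) (∑ₚ-pick w β) ⟩
    (+ q * β w) * β w + β w * b                          ≡⟨ collect (+ q) (β w) b ⟩
    + q * (β w * β w) + b * β w                          ≡⟨ cong (λ x → + q * x + b * β w) (𝟙ℤ-idem (member Y w)) ⟩
    + q * β w + b * β w                                  ∎
    where
    open ≡-Reasoning
    split : ∀ x y k d → (x * y) * (k * d + 1ℤ) ≡ (k * x) * (d * y) + x * y
    split = solve-∀
    collect : ∀ k x s → (k * x) * x + x * s ≡ k * (x * x) + s * x
    collect = solve-∀

  ∑r²≤ : ∑ₚ (λ u → r u * r u) ≤ + q * b + b * b
  ∑r²≤ = begin
    ∑ₚ (λ u → r u * r u)                                    ≡⟨ ∑r²≡ ⟩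
    ∑ₚ (λ w → ∑ₚ (λ z → (β w * β z) * common w z))          ≤⟨ ∑ₚ-mono (λ w → ∑ₚ-mono (λ z → pair-bound w z)) ⟩
    ∑ₚ (λ w → ∑ₚ (λ z → (β w * β z) * (+ q * δ z w + 1ℤ))) ≡⟨ ∑ₚ-cong row-sum ⟩
    ∑ₚ (λ w → + q * β w + b * β w)                          ≡⟨ ∑ₚ-lin₂ (+ q) b β β ⟩
    + q * b + b * b                                         ∎
    where open ℤP.≤-Reasoning

  variance : ∑ₚ (λ u → (+ q * r u - b) * (+ q * r u - b)) ≤ + q * (+ q * + q) * b
  variance = begin
    ∑ₚ (λ u → (+ q * r u - b) * (+ q * r u - b))
      ≡⟨ ∑ₚ-square-expand (+ q) b r ⟩
    (+ q * + q) * ∑ₚ (λ u → r u * r u) + (- (+ 2) * + q * b) * ∑ₚ r + (b * b) * ∑ₚ {q} {q} (λ _ → 1ℤ)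
      ≤⟨ ℤP.+-monoˡ-≤ ((b * b) * ∑ₚ {q} {q} (λ _ → 1ℤ)) (ℤP.+-monoˡ-≤ ((- (+ 2) * + q * b) * ∑ₚ r)
           (ℤP.*-monoˡ-≤-nonNeg (+ q * + q) {{ℤ.nonNegative (square-nonNeg (+ q))}} ∑r²≤)) ⟩
    (+ q * + q) * (+ q * b + b * b) + (- (+ 2) * + q * b) * ∑ₚ r + (b * b) * ∑ₚ {q} {q} (λ _ → 1ℤ)
      ≡⟨ cong₂ (λ x y → (+ q * + q) * (+ q * b + b * b) + (- (+ 2) * + q * b) * x + (b * b) * y)
               ∑r (∑ₚ-const q q 1ℤ) ⟩
    (+ q * + q) * (+ q * b + b * b) + (- (+ 2) * + q * b) * (+ q * b) + (b * b) * (+ q * (+ q * 1ℤ))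
      ≡⟨ simplify (+ q) b ⟩
    + q * (+ q * + q) * b ∎
    where
    open ℤP.≤-Reasoning
    simplify : ∀ k s → (k * k) * (k * s + s * s) + (- (+ 2) * k * s) * (k * s) + (s * s) * (k * (k * 1ℤ)) ≡ k * (k * k) * s
    simplify = solve-∀

  S : ℤ
  S = ∑ₚ (λ u → α u * r u)

  deviation≡ : ∑ₚ (λ u → α u * (+ q * r u - b)) ≡ + q * S - a * b
  deviation≡ = trans (∑ₚ-cong (λ u → distribute (α u) (r u) (+ q) b))
                     (trans (∑ₚ-lin₂ (+ q) (- b) (λ u → α u * r u) α) (finish (+ q) S a b))
    where
    distribute : ∀ x y k s → x * (k * y - s) ≡ k * (x * y) + (- s) * x
    distribute = solve-∀
    finish : ∀ k s a b → k * s + (- b) * a ≡ k * s - a * b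
    finish = solve-∀

  -- By Cauchy–Schwarz with weights α ≤ 1:  (q S − a b)² ≤ a · Σ_u (q r(u) − b)².
  deviation² : (+ q * S - a * b) * (+ q * S - a * b) ≤ (a * b) * (+ q * (+ q * + q))
  deviation² = begin
    (+ q * S - a * b) * (+ q * S - a * b)   ≡⟨ cong₂ _*_ (sym deviation≡) (sym deviation≡) ⟩
    ∑ₚ (λ u → α u * centred u) * ∑ₚ (λ u → α u * centred u)
      ≤⟨ cauchySchwarz α centred (λ u → 𝟙ℤ-nonNeg (member X u)) ⟩
    a * ∑ₚ (λ u → α u * (centred u * centred u))
      ≤⟨ ℤP.*-monoˡ-≤-nonNeg a {{ℤ.nonNegative (∑ₚ-nonNeg (λ u → 𝟙ℤ-nonNeg (member X u)))}}
           (ℤP.≤-trans (∑ₚ-mono drop-weight) variance) ⟩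
    a * (+ q * (+ q * + q) * b)             ≡⟨ reorder a (+ q) b ⟩
    (a * b) * (+ q * (+ q * + q))           ∎
    where
    open ℤP.≤-Reasoning
    centred : Point → ℤ
    centred u = + q * r u - b
    drop-weight : ∀ u → α u * (centred u * centred u) ≤ centred u * centred u
    drop-weight u = ℤP.≤-trans
      (ℤP.*-monoʳ-≤-nonNeg (centred u * centred u) {{ℤ.nonNegative (square-nonNeg (centred u))}} (𝟙ℤ≤1 (member X u)))
      (ℤP.≤-reflexive (ℤP.*-identityˡ (centred u * centred u)))
    reorder : ∀ a k b → a * (k * (k * k) * b) ≡ (a * b) * (k * (k * k))
    reorder = solve-∀

  sizeSum≡ : ∀ Z → + sizeSum F Z ≡ ∑ₚ (λ u → 𝟙ℤ (member Z u))
  sizeSum≡ Z = trans (sumFin-ℤ (λ x → 𝟙 (nonzero F x) ℕ.* ∣ Z x ∣)) (sum-cong-≗ {q} row)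
    where
    open ≡-Reasoning
    row : ∀ x → + (𝟙 (nonzero F x) ℕ.* ∣ Z x ∣) ≡ ∑[ x′ < q ] 𝟙ℤ (member Z (x , x′))
    row x = begin
      + (𝟙 (nonzero F x) ℕ.* ∣ Z x ∣)                       ≡⟨ ℤP.pos-* (𝟙 (nonzero F x)) ∣ Z x ∣ ⟩
      𝟙ℤ (nonzero F x) * + ∣ Z x ∣                          ≡⟨ cong (λ n → 𝟙ℤ (nonzero F x) * + n) (∣p∣-as-sum (Z x)) ⟩
      𝟙ℤ (nonzero F x) * + sumFin (λ x′ → 𝟙 (does (x′ ∈? Z x)))
        ≡⟨ cong (𝟙ℤ (nonzero F x) *_) (sumFin-ℤ (λ x′ → 𝟙 (does (x′ ∈? Z x)))) ⟩
      𝟙ℤ (nonzero F x) * ∑[ x′ < q ] 𝟙ℤ (does (x′ ∈? Z x))  ≡⟨ *-distribˡ-sum (𝟙ℤ (nonzero F x)) (λ x′ → 𝟙ℤ (does (x′ ∈? Z x))) ⟩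
      ∑[ x′ < q ] (𝟙ℤ (nonzero F x) * 𝟙ℤ (does (x′ ∈? Z x))) ≡⟨ sum-cong-≗ {q} (λ x′ → sym (𝟙ℤ-∧ (nonzero F x) (does (x′ ∈? Z x)))) ⟩
      ∑[ x′ < q ] 𝟙ℤ (member Z (x , x′))                    ∎

  countT≡ : + countT F X Y ≡ a * b
  countT≡ = trans (ℤP.pos-* (sizeSum F X) (sizeSum F Y)) (cong₂ _*_ (sizeSum≡ X) (sizeSum≡ Y))

  countS≡ : + countS F X Y ≡ S
  countS≡ = begin
    + countS F X Y
      ≡⟨ trans (sumFin-ℤ (λ x → sumFin λ y → sumFin λ x′ → sumFin λ y′ → 𝟙 (condition x y x′ y′)))
           (sum-cong-≗ {q} λ x → trans (sumFin-ℤ (λ y → sumFin λ x′ → sumFin λ y′ → 𝟙 (condition x y x′ y′)))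
           (sum-cong-≗ {q} λ y → trans (sumFin-ℤ (λ x′ → sumFin λ y′ → 𝟙 (condition x y x′ y′)))
           (sum-cong-≗ {q} λ x′ → sumFin-ℤ (λ y′ → 𝟙 (condition x y x′ y′))))) ⟩
    ∑[ x < q ] ∑[ y < q ] ∑[ x′ < q ] ∑[ y′ < q ] 𝟙ℤ (condition x y x′ y′)
      ≡⟨ sum-cong-≗ {q} (λ x → sum-cong-≗ {q} λ y → sum-cong-≗ {q} λ x′ → sum-cong-≗ {q} λ y′ →
           split (nonzero F x) (nonzero F y) (does (x′ ∈? X x)) (does (y′ ∈? Y y)) _) ⟩
    ∑[ x < q ] ∑[ y < q ] ∑[ x′ < q ] ∑[ y′ < q ] weighted (x , x′) (y , y′)
      ≡⟨ sum-cong-≗ {q} (λ x → ∑-comm (λ y x′ → ∑[ y′ < q ] weighted (x , x′) (y , y′))) ⟩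
    ∑ₚ (λ u → ∑ₚ (λ w → weighted u w))
      ≡⟨ ∑ₚ-cong (λ u → ∑ₚ-* (α u) (λ w → β w * incidence u w)) ⟩
    S ∎
    where
    open ≡-Reasoning
    condition : Fin q → Fin q → Fin q → Fin q → Bool
    condition x y x′ y′ = nonzero F x ∧ nonzero F y ∧ does (x′ ∈? X x) ∧ does (y′ ∈? Y y)
                          ∧ does (((x , x′) ∈ℓ? (y , y′)))
    weighted : Point → Point → ℤ
    weighted u w = α u * (β w * incidence u w)
    split : ∀ p s c d e → 𝟙ℤ (p ∧ s ∧ c ∧ d ∧ e) ≡ 𝟙ℤ (p ∧ c) * (𝟙ℤ (s ∧ d) * 𝟙ℤ e)
    split p s c d e = begin
      𝟙ℤ (p ∧ s ∧ c ∧ d ∧ e)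
        ≡⟨ trans (𝟙ℤ-∧ p _) (cong (𝟙ℤ p *_) (trans (𝟙ℤ-∧ s _) (cong (𝟙ℤ s *_) (trans (𝟙ℤ-∧ c _) (cong (𝟙ℤ c *_) (𝟙ℤ-∧ d e)))))) ⟩
      𝟙ℤ p * (𝟙ℤ s * (𝟙ℤ c * (𝟙ℤ d * 𝟙ℤ e)))
        ≡⟨ shuffle (𝟙ℤ p) (𝟙ℤ s) (𝟙ℤ c) (𝟙ℤ d) (𝟙ℤ e) ⟩
      (𝟙ℤ p * 𝟙ℤ c) * ((𝟙ℤ s * 𝟙ℤ d) * 𝟙ℤ e)
        ≡⟨ sym (cong₂ (λ x y → x * (y * 𝟙ℤ e)) (𝟙ℤ-∧ p c) (𝟙ℤ-∧ s d)) ⟩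
      𝟙ℤ (p ∧ c) * (𝟙ℤ (s ∧ d) * 𝟙ℤ e) ∎
      where
      shuffle : ∀ p s c d e → p * (s * (c * (d * e))) ≡ (p * c) * ((s * d) * e)
      shuffle = solve-∀

  integer-bound : (+ q * + countS F X Y - + countT F X Y) * (+ q * + countS F X Y - + countT F X Y)
                  ≤ + countT F X Y * (+ q * (+ q * + q))
  integer-bound = subst₂ (λ s t → (+ q * s - t) * (+ q * s - t) ≤ t * (+ q * (+ q * + q)))
                         (sym countS≡) (sym countT≡) deviation²

module RationalForm where

  open import Data.Integer as ℤ using (ℤ; +_)
  open import Data.Rational using (ℚ; _/_; _+_; _-_; _*_; _≤_; 0ℚ; 1ℚ; toℚᵘ)
  import Data.Rational as ℚ
  import Data.Rational.Properties as ℚP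
  open import Data.Rational.Unnormalised as ℚᵘ using (ℚᵘ; mkℚᵘ; *≡*; *≤*; _≃_)
  import Data.Rational.Unnormalised.Properties as ℚᵘP

  toℚᵘ-/ : ∀ i m → toℚᵘ (i / suc m) ≃ mkℚᵘ i m
  toℚᵘ-/ i m = ℚP.toℚᵘ-fromℚᵘ (mkℚᵘ i m)

  deviation≃ : ∀ n t q′ → toℚᵘ ((+ n / 1) - (+ t / suc q′)) ≃ mkℚᵘ (+ suc q′ ℤ.* + n ℤ.- + t) q′
  deviation≃ n t q′ =
    ℚᵘP.≃-trans (ℚP.toℚᵘ-homo-+ (+ n / 1) (ℚ.- (+ t / suc q′)))
      (ℚᵘP.≃-trans (ℚᵘP.+-cong (toℚᵘ-/ (+ n) 0) (ℚᵘP.≃-trans (ℚP.toℚᵘ-homo‿- (+ t / suc q′)) (ℚᵘP.-‿cong (toℚᵘ-/ (+ t) q′))))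
        (*≡* (trans (cross-multiply (+ n) (+ t) (+ suc q′)) (cong ((+ suc q′ ℤ.* + n ℤ.- + t) ℤ.*_) (sym (ℤP.pos-* 1 (suc q′)))))))
    where
    cross-multiply : ∀ n t q → (n ℤ.* q ℤ.+ (ℤ.- t) ℤ.* + 1) ℤ.* q ≡ (q ℤ.* n ℤ.- t) ℤ.* (+ 1 ℤ.* q)
    cross-multiply = solve-∀

  -- Dividing  (q n − t)² ≤ t q³  by q² gives  (n − t/q)² ≤ t q, written with
  -- the factor (1 + ε)² of the theorem at ε = 0.
  rational-bound : ∀ q′ n t → let q = suc q′ in
    (+ q ℤ.* + n ℤ.- + t) ℤ.* (+ q ℤ.* + n ℤ.- + t) ℤ.≤ + t ℤ.* (+ q ℤ.* (+ q ℤ.* + q)) →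
    let d = (+ n / 1) - (+ t / q) in
    d * d ≤ ((1ℚ + 0ℚ) * (1ℚ + 0ℚ)) * ((+ t / 1) * (+ q / 1))
  rational-bound q′ n t bound =
    ℚP.toℚᵘ-cancel-≤ (ℚᵘP.≤-respˡ-≃ (ℚᵘP.≃-sym lhs≃) (ℚᵘP.≤-respʳ-≃ (ℚᵘP.≃-sym rhs≃) fraction-bound))
    where
    q : ℕ
    q = suc q′
    D : ℤ
    D = + q ℤ.* + n ℤ.- + t
    d : ℚ
    d = (+ n / 1) - (+ t / q)
    M tq : ℚᵘ
    M  = mkℚᵘ D q′
    tq = mkℚᵘ (+ t) 0 ℚᵘ.* mkℚᵘ (+ q) 0
    fraction-bound : M ℚᵘ.* M ℚᵘ.≤ tq
    fraction-bound = *≤* (subst₂ ℤ._≤_ (sym (ℤP.*-identityʳ (D ℤ.* D)))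
      (trans (regroup (+ t) (+ q)) (cong ((+ t ℤ.* + q) ℤ.*_) (sym (ℤP.pos-* q q)))) bound)
      where
      regroup : ∀ t q → t ℤ.* (q ℤ.* (q ℤ.* q)) ≡ (t ℤ.* q) ℤ.* (q ℤ.* q)
      regroup = solve-∀
    lhs≃ : toℚᵘ (d * d) ≃ M ℚᵘ.* M
    lhs≃ = ℚᵘP.≃-trans (ℚP.toℚᵘ-homo-* d d) (ℚᵘP.*-cong (deviation≃ n t q′) (deviation≃ n t q′))
    one : (1ℚ + 0ℚ) * (1ℚ + 0ℚ) ≡ 1ℚ
    one = trans (cong₂ _*_ (ℚP.+-identityʳ 1ℚ) (ℚP.+-identityʳ 1ℚ)) (ℚP.*-identityˡ 1ℚ)
    rhs≃ : toℚᵘ (((1ℚ + 0ℚ) * (1ℚ + 0ℚ)) * ((+ t / 1) * (+ q / 1))) ≃ tq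
    rhs≃ = ℚᵘP.≃-trans (ℚᵘP.≃-reflexive (cong toℚᵘ (trans (cong (_* ((+ t / 1) * (+ q / 1))) one) (ℚP.*-identityˡ _))))
             (ℚᵘP.≃-trans (ℚP.toℚᵘ-homo-* (+ t / 1) (+ q / 1)) (ℚᵘP.*-cong (toℚᵘ-/ (+ t) 0) (toℚᵘ-/ (+ q) 0)))

open import Data.Nat using (NonZero)
open import Data.Integer using (+_)
open import Data.Rational using (ℚ; _/_; _+_; _-_; _*_; _≤_; _<_; 0ℚ; 1ℚ)
import Data.Rational.Properties as ℚP
open import Data.Fin.Subset using (_∉_)
open import Data.Product using (_×_; ∃; _,_)
open RationalForm using (rational-bound)

-- The theorem holds with ε = 0, i.e. |θ| ≤ 1.
mainTheorem7 :
  ∃ λ (ε : ℕ → ℚ) →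
    (∀ n → 0ℚ ≤ ε n) ×
    (∀ (δ : ℚ) → 0ℚ < δ → ∃ λ (N : ℕ) → ∀ n → N ℕ.≤ n → ε n ≤ δ) ×
    (∀ (q : ℕ) .{{_ : NonZero q}} (F : FiniteField q) (X Y : Fin q → Subset q) →
      (∀ x → FiniteField.0# F ∉ X x) → (∀ y → FiniteField.0# F ∉ Y y) →
      let S = + countS F X Y / 1
          T = + countT F X Y / 1
          d = S - (+ countT F X Y / q)
      in d * d ≤ ((1ℚ + ε q) * (1ℚ + ε q)) * (T * (+ q / 1)))
mainTheorem7 =
  (λ _ → 0ℚ) , (λ _ → ℚP.≤-refl) , (λ δ 0<δ → 0 , λ _ _ → ℚP.<⇒≤ 0<δ) ,
  λ { (suc q′) F X Y _ _ → rational-bound q′ (countS F X Y) (countT F X Y) (Estimate.integer-bound F X Y) }
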